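{- Let $a,b$ be positive integers. If property $Q(a)$ and property $Q(b)$ hold, then property $Q(ab)$ holds.
   Context: For a positive integer $r$, property $Q(r)$ is the statement: for all positive integers $n,m$ such that $n+m$ is a multiple of $r$, and all $v_1,\dots,v_n\in\mathbb{R}_{\ge0}^m$ (cookie $i$ carries amount $v_{i,j}$ of frosting of kind $j$), there exists a distribution $(w_{i,c})_{1\le i\le n,1\le c\le r}$ of the cookies among $r$ children such that for every child $c$ and every kind $j$, $\sum_i w_{i,c}v_{i,j}=\frac1r\sum_i v_{i,j}$, at most $(r-1)m$ cookies are cut, and every child receives at least $\frac{n-(r-1)m}{r}$ full cookies. A distribution is an array of reals $w_{i,c}\ge0$ with $\sum_{c=1}^r w_{i,c}=1$ for each $i$; cookie $i$ is cut if $w_{i,c}\notin\{0,1\}$ for some $c$; child $c$ receives cookie $i$ as a full cookie if $w_{i,c}=1$. -}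

module Defs where

open import Data.Nat using (ℕ; zero; suc; _∸_) renaming (_+_ to _+ℕ_; _*_ to _*ℕ_; _≤_ to _≤ℕ_)
open import Data.Nat.Divisibility using (_∣_)
open import Data.Fin using (Fin; zero; suc)
open import Data.Fin.Subset using (Subset; _∈_; _∉_; ∣_∣)
open import Data.Product using (Σ; _×_; ∃)
open import Data.Sum using (_⊎_)
open import Relation.Nullary using (¬_)
open import Relation.Binary.PropositionalEquality using (_≡_)
open import Relation.Binary.Structures using (IsTotalOrder)
open import Algebra.Structures using (IsCommutativeRing)

-- The real numbers, axiomatised as a Dedekind-complete ordered field
-- (classically this determines ℝ up to isomorphism).
record RealField : Set₁ where
  infixl 6 _+_
  infixl 7 _*_
  infix 4 _≤_
  field
    Carrier : Set
    _+_ _*_ : Carrier → Carrier → Carrier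
    -_ : Carrier → Carrier
    0# 1# : Carrier
    _≤_ : Carrier → Carrier → Set
    isCommutativeRing : IsCommutativeRing _≡_ _+_ _*_ -_ 0# 1#
    0≢1 : ¬ (0# ≡ 1#)
    inverse : ∀ x → ¬ (x ≡ 0#) → Σ Carrier (λ y → x * y ≡ 1#)
    isTotalOrder : IsTotalOrder _≡_ _≤_
    +-mono-≤ : ∀ {x y} z → x ≤ y → x + z ≤ y + z
    *-nonneg : ∀ {x y} → 0# ≤ x → 0# ≤ y → 0# ≤ x * y
    lub : (P : Carrier → Set) → Σ Carrier P →
          Σ Carrier (λ u → ∀ x → P x → x ≤ u) →
          Σ Carrier (λ s → (∀ x → P x → x ≤ s) ×
                           (∀ u → (∀ x → P x → x ≤ u) → s ≤ u))

module _ (ℝ : RealField) where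
  open RealField ℝ

  ∑ : ∀ {n} → (Fin n → Carrier) → Carrier
  ∑ {zero} f = 0#
  ∑ {suc n} f = f zero + ∑ (λ i → f (suc i))

  ι : ℕ → Carrier
  ι zero = 0#
  ι (suc k) = 1# + ι k

  -- w is a distribution of n cookies among r children
  IsDistribution : ∀ {n r} → (Fin n → Fin r → Carrier) → Set
  IsDistribution {n} {r} w =
    (∀ i c → 0# ≤ w i c) × (∀ i → ∑ (λ c → w i c) ≡ 1#)

  Uncut : ∀ {n r} → (Fin n → Fin r → Carrier) → Fin n → Set
  Uncut w i = ∀ c → (w i c ≡ 0#) ⊎ (w i c ≡ 1#)

  -- Property Q(r).  "each child gets 1/r of each kind" is written as
  -- r · (child's amount) = total;  "at most (r-1)m cut cookies" as: the cut
  -- cookies lie in a set of size ≤ (r-1)m;  "at least (n-(r-1)m)/r full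
  -- cookies" as: a set F of cookies received fully with r·|F| + (r-1)m ≥ n.
  Q : ℕ → Set
  Q r = ∀ (n m : ℕ) → 1 ≤ℕ n → 1 ≤ℕ m → r ∣ (n +ℕ m) →
        (v : Fin n → Fin m → Carrier) → (∀ i j → 0# ≤ v i j) →
        Σ (Fin n → Fin r → Carrier) λ w →
          IsDistribution w ×
          (∀ c j → ι r * ∑ (λ i → w i c * v i j) ≡ ∑ (λ i → v i j)) ×
          Σ (Subset n) (λ S → (∣ S ∣ ≤ℕ (r ∸ 1) *ℕ m) ×
                              (∀ i → i ∉ S → Uncut w i)) ×
          (∀ c → Σ (Subset n) λ F →
                   (n ≤ℕ r *ℕ ∣ F ∣ +ℕ (r ∸ 1) *ℕ m) ×
                   (∀ i → i ∈ F → w i c ≡ 1#))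

{-# OPTIONS --safe #-}

-- Write a = a′ + 1, b = b′ + 1 and n + m = k a b.  A fair division among a children (Q(a))
-- gives each child c a set F c of full cookies, and these sets are pairwise disjoint.  If
-- b k ≤ m, then n ≤ (a − 1) m, the bounds on cut and full cookies hold for any division, and
-- it suffices to divide each child's portion fairly among b children (Q(b)).  Otherwise child c
-- glues its portion into q = b k − m ≥ 1 groups, each containing a cookie of F c, and divides
-- the groups among b children (Q(b) applies since q + m = b k).  A cookie stays whole if it
-- lies in some F c and its group is not cut; a full group yields a full cookie of F c.
-- Counting these cookies gives the bounds for a b children, since n = a q + (a − 1) m.
module Submission where

open import Defs
open import Data.Nat using (ℕ; _*_; _≤_)

open import Algebra.Bundles using (CommutativeRing)
open import Data.Fin using (Fin; zero; suc; _↑ˡ_; _↑ʳ_; combine; remQuot; punchIn; punchOut)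
import Data.Fin.Properties as Fin
open import Data.Fin.Subset
open import Data.Fin.Subset.Properties
open import Data.List using (tabulate)
import Data.Nat as ℕ
open import Data.Nat using (zero; suc; _∸_; z≤n; s≤s)
open import Data.Nat.Divisibility using (_∣_; divides; ∣-trans; m∣m*n; n∣m*n)
import Data.Nat.Properties as ℕₚ
open import Data.Product using (∃-syntax; _×_; _,_; proj₁; proj₂)
open import Data.Sum as Sum using (_⊎_; inj₁; inj₂)
open import Data.Vec using ([]; _∷_; lookup; here; there)
import Data.Vec as Vec
open import Data.Vec.Functional using (removeAt)
open import Data.Vec.Properties using (lookup∘tabulate; []=⇒lookup; lookup⇒[]=)
open import Function using (id; _∘_; case_of_)
open import Level using (0ℓ)
open import Relation.Binary.PropositionalEquality
open import Relation.Binary.Structures using (IsTotalOrder)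
open import Relation.Nullary using (yes; no; contradiction)

-- Counting in finite subsets

-- ℕ's _+_ is opened only locally, since the field's _+_ is used unqualified further down.
module _ where
  open import Data.Nat using (_+_)
  open import Data.Nat.Properties

  Disjoint : ∀ {n} → Subset n → Subset n → Set
  Disjoint p q = ∀ {x} → x ∈ p → x ∉ q

  PairwiseDisjoint : ∀ {a n} → (Fin a → Subset n) → Set
  PairwiseDisjoint X = ∀ {c c′} → c ≢ c′ → Disjoint (X c) (X c′)

  drop-∷-Disjoint : ∀ {n s t} {p q : Subset n} → Disjoint (s ∷ p) (t ∷ q) → Disjoint p q
  drop-∷-Disjoint disjoint x∈p x∈q = disjoint (there x∈p) (there x∈q)

  ∣p∪q∣≤∣p∣+∣q∣ : ∀ {n} (p q : Subset n) → ∣ p ∪ q ∣ ≤ ∣ p ∣ + ∣ q ∣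
  ∣p∪q∣≤∣p∣+∣q∣ []            []            = z≤n
  ∣p∪q∣≤∣p∣+∣q∣ (outside ∷ p) (outside ∷ q) = ∣p∪q∣≤∣p∣+∣q∣ p q
  ∣p∪q∣≤∣p∣+∣q∣ (outside ∷ p) (inside  ∷ q) =
    ≤-trans (s≤s (∣p∪q∣≤∣p∣+∣q∣ p q)) (≤-reflexive (sym (+-suc ∣ p ∣ ∣ q ∣)))
  ∣p∪q∣≤∣p∣+∣q∣ (inside  ∷ p) (outside ∷ q) = s≤s (∣p∪q∣≤∣p∣+∣q∣ p q)
  ∣p∪q∣≤∣p∣+∣q∣ (inside  ∷ p) (inside  ∷ q) =
    s≤s (≤-trans (∣p∪q∣≤∣p∣+∣q∣ p q) (+-monoʳ-≤ ∣ p ∣ (n≤1+n ∣ q ∣)))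

  Disjoint⇒∣p∪q∣≡∣p∣+∣q∣ : ∀ {n} (p q : Subset n) → Disjoint p q → ∣ p ∪ q ∣ ≡ ∣ p ∣ + ∣ q ∣
  Disjoint⇒∣p∪q∣≡∣p∣+∣q∣ []            []            _        = refl
  Disjoint⇒∣p∪q∣≡∣p∣+∣q∣ (outside ∷ p) (outside ∷ q) disjoint =
    Disjoint⇒∣p∪q∣≡∣p∣+∣q∣ p q (drop-∷-Disjoint disjoint)
  Disjoint⇒∣p∪q∣≡∣p∣+∣q∣ (outside ∷ p) (inside  ∷ q) disjoint =
    trans (cong suc (Disjoint⇒∣p∪q∣≡∣p∣+∣q∣ p q (drop-∷-Disjoint disjoint))) (sym (+-suc ∣ p ∣ ∣ q ∣))
  Disjoint⇒∣p∪q∣≡∣p∣+∣q∣ (inside  ∷ p) (outside ∷ q) disjoint =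
    cong suc (Disjoint⇒∣p∪q∣≡∣p∣+∣q∣ p q (drop-∷-Disjoint disjoint))
  Disjoint⇒∣p∪q∣≡∣p∣+∣q∣ (inside  ∷ p) (inside  ∷ q) disjoint = contradiction here (disjoint here)

  ∣p∣≤suc∣p∩∁⁅x⁆∣ : ∀ {n} (p : Subset n) x → ∣ p ∣ ≤ suc ∣ p ∩ ∁ ⁅ x ⁆ ∣
  ∣p∣≤suc∣p∩∁⁅x⁆∣ p x = begin
    ∣ p ∣                          ≤⟨ p⊆q⇒∣p∣≤∣q∣ p⊆[p∩∁⁅x⁆]∪⁅x⁆ ⟩
    ∣ p ∩ ∁ ⁅ x ⁆ ∪ ⁅ x ⁆ ∣        ≤⟨ ∣p∪q∣≤∣p∣+∣q∣ (p ∩ ∁ ⁅ x ⁆) ⁅ x ⁆ ⟩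
    ∣ p ∩ ∁ ⁅ x ⁆ ∣ + ∣ ⁅ x ⁆ ∣    ≡⟨ cong (∣ p ∩ ∁ ⁅ x ⁆ ∣ +_) (∣⁅x⁆∣≡1 x) ⟩
    ∣ p ∩ ∁ ⁅ x ⁆ ∣ + 1            ≡⟨ +-comm _ 1 ⟩
    suc ∣ p ∩ ∁ ⁅ x ⁆ ∣            ∎
    where
    open ≤-Reasoning
    p⊆[p∩∁⁅x⁆]∪⁅x⁆ : p ⊆ p ∩ ∁ ⁅ x ⁆ ∪ ⁅ x ⁆
    p⊆[p∩∁⁅x⁆]∪⁅x⁆ {y} y∈p with y Fin.≟ x
    ... | yes refl = x∈p∪q⁺ (inj₂ (x∈⁅x⁆ x))
    ... | no  y≢x  = x∈p∪q⁺ (inj₁ (x∈p∩q⁺ (y∈p , x∉p⇒x∈∁p (x≢y⇒x∉⁅y⁆ y≢x))))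

  ⋃ᶠ : ∀ {a n} → (Fin a → Subset n) → Subset n
  ⋃ᶠ X = ⋃ (tabulate X)

  x∈⋃ᶠ⁻ : ∀ {a n} (X : Fin a → Subset n) {x} → x ∈ ⋃ᶠ X → ∃[ c ] x ∈ X c
  x∈⋃ᶠ⁻ {zero}  X x∈⊥ = contradiction x∈⊥ ∉⊥
  x∈⋃ᶠ⁻ {suc a} X x∈⋃ with x∈p∪q⁻ (X zero) _ x∈⋃
  ... | inj₁ x∈X₀ = zero , x∈X₀
  ... | inj₂ x∈⋃′ = let c , x∈X = x∈⋃ᶠ⁻ (X ∘ suc) x∈⋃′ in suc c , x∈X

  PairwiseDisjoint⇒*≤∣⋃ᶠ∣ : ∀ {a n t} (X : Fin a → Subset n) → PairwiseDisjoint X →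
                            (∀ c → t ≤ ∣ X c ∣) → a * t ≤ ∣ ⋃ᶠ X ∣
  PairwiseDisjoint⇒*≤∣⋃ᶠ∣ {zero}  X disjoint t≤ = z≤n
  PairwiseDisjoint⇒*≤∣⋃ᶠ∣ {suc a} {n} X disjoint t≤ = begin
    suc a * _               ≤⟨ +-mono-≤ (t≤ zero) (PairwiseDisjoint⇒*≤∣⋃ᶠ∣ (X ∘ suc) disjoint′ (t≤ ∘ suc)) ⟩
    ∣ X zero ∣ + ∣ ⋃ᶠ X′ ∣  ≡⟨ Disjoint⇒∣p∪q∣≡∣p∣+∣q∣ (X zero) (⋃ᶠ X′) X₀-disjoint ⟨
    ∣ ⋃ᶠ X ∣                ∎
    where
    open ≤-Reasoning
    X′ : Fin a → Subset n
    X′ = X ∘ suc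
    disjoint′ : PairwiseDisjoint X′
    disjoint′ c≢c′ = disjoint (c≢c′ ∘ Fin.suc-injective)
    X₀-disjoint : Disjoint (X zero) (⋃ᶠ X′)
    X₀-disjoint x∈X₀ x∈⋃ = let c , x∈X = x∈⋃ᶠ⁻ X′ x∈⋃ in disjoint (λ ()) x∈X₀ x∈X

  preimage : ∀ {n q} → (Fin n → Fin q) → Subset q → Subset n
  preimage f T = Vec.tabulate (λ x → lookup T (f x))

  module _ {n q} {f : Fin n → Fin q} {T : Subset q} {x : Fin n} where

    x∈preimage⁺ : f x ∈ T → x ∈ preimage f T
    x∈preimage⁺ fx∈T = lookup⇒[]= x _ (trans (lookup∘tabulate _ x) ([]=⇒lookup fx∈T))

    x∈preimage⁻ : x ∈ preimage f T → f x ∈ T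
    x∈preimage⁻ x∈f⁻¹T = lookup⇒[]= (f x) T (trans (sym (lookup∘tabulate _ x)) ([]=⇒lookup x∈f⁻¹T))

  MapsOnto : ∀ {n q} → (Fin n → Fin q) → Subset n → Subset q → Set
  MapsOnto f Y T = ∀ {y} → y ∈ T → ∃[ x ] x ∈ Y × f x ≡ y

  MapsOnto⇒∣T∣≤∣Y∣ : ∀ {n q} (f : Fin n → Fin q) (Y : Subset n) (T : Subset q) →
                     MapsOnto f Y T → ∣ T ∣ ≤ ∣ Y ∣
  MapsOnto⇒∣T∣≤∣Y∣ {q = q} f [] T onto =
    ≤-reflexive (trans (cong ∣_∣ (Empty-unique λ (_ , y∈T) → case onto y∈T of λ ())) (∣⊥∣≡0 q))
  MapsOnto⇒∣T∣≤∣Y∣ f (outside ∷ Y) T onto = MapsOnto⇒∣T∣≤∣Y∣ (f ∘ suc) Y T onto′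
    where
    onto′ : MapsOnto (f ∘ suc) Y T
    onto′ y∈T with onto y∈T
    ... | suc x , there x∈Y , fx≡y = x , x∈Y , fx≡y
  MapsOnto⇒∣T∣≤∣Y∣ f (inside ∷ Y) T onto =
    ≤-trans (∣p∣≤suc∣p∩∁⁅x⁆∣ T (f zero)) (s≤s (MapsOnto⇒∣T∣≤∣Y∣ (f ∘ suc) Y (T ∩ ∁ ⁅ f zero ⁆) onto′))
    where
    onto′ : MapsOnto (f ∘ suc) Y (T ∩ ∁ ⁅ f zero ⁆)
    onto′ y∈T∩∁⁅f₀⁆ with x∈p∩q⁻ T _ y∈T∩∁⁅f₀⁆
    ... | y∈T , y∈∁⁅f₀⁆ with onto y∈T
    ...   | zero  , _         , refl = contradiction (x∈⁅x⁆ (f zero)) (x∈∁p⇒x∉p y∈∁⁅f₀⁆)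
    ...   | suc x , there x∈Y , fx≡y = x , x∈Y , fx≡y

  MapsOnto-∩-preimage : ∀ {n q} {f : Fin n → Fin q} {Y : Subset n} (T : Subset q) →
                        MapsOnto f Y ⊤ → MapsOnto f (Y ∩ preimage f T) T
  MapsOnto-∩-preimage T onto {y} y∈T with onto (∈⊤ {x = y})
  ... | x , x∈Y , refl = x , x∈p∩q⁺ (x∈Y , x∈preimage⁺ y∈T) , refl

  ≤∣Y∣⇒∃MapsOnto-⊤ : ∀ {n q} (Y : Subset n) → suc q ≤ ∣ Y ∣ → ∃[ f ] MapsOnto {q = suc q} f Y ⊤
  ≤∣Y∣⇒∃MapsOnto-⊤ (outside ∷ Y) q<∣Y∣ =
    let f , onto = ≤∣Y∣⇒∃MapsOnto-⊤ Y q<∣Y∣ in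
    (λ { zero → zero ; (suc x) → f x }) ,
    λ y∈⊤ → let x , x∈Y , fx≡y = onto y∈⊤ in suc x , there x∈Y , fx≡y
  ≤∣Y∣⇒∃MapsOnto-⊤ {q = zero}  (inside ∷ Y) _ = (λ _ → zero) , λ { {zero} _ → zero , here , refl }
  ≤∣Y∣⇒∃MapsOnto-⊤ {q = suc q} (inside ∷ Y) (s≤s q<∣Y∣) =
    let f , onto = ≤∣Y∣⇒∃MapsOnto-⊤ Y q<∣Y∣ in
    (λ { zero → zero ; (suc x) → suc (f x) }) ,
    λ { {zero}  _ → zero , here , refl
      ; {suc y} _ → let x , x∈Y , fx≡y = onto (∈⊤ {x = y}) in suc x , there x∈Y , cong suc fx≡y }

-- Arithmetic of the two cases

-- Here a = suc a′, b = suc b′, and a * b ∸ 1 reduces to b′ + a′ * suc b′.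
module _ {a′ b′ m : ℕ} where
  open import Data.Nat using (_+_; _<_)
  open import Data.Nat.Properties
  open import Data.Nat.Tactic.RingSolver using (solve-∀)
  open ≤-Reasoning

  few-cookies-bound : ∀ {n k} → n + m ≡ k * (suc a′ * suc b′) → suc b′ * k ≤ m → n ≤ (b′ + a′ * suc b′) * m
  few-cookies-bound {n} {k} n+m≡kab bk≤m = +-cancelʳ-≤ m n _ (begin
    n + m                       ≡⟨ n+m≡kab ⟩
    k * (suc a′ * suc b′)       ≡⟨ lemma a′ b′ k ⟩
    suc a′ * (suc b′ * k)       ≤⟨ *-monoʳ-≤ (suc a′) bk≤m ⟩
    suc a′ * m                  ≡⟨ +-comm m (a′ * m) ⟩
    a′ * m + m                  ≤⟨ +-monoˡ-≤ m (*-monoˡ-≤ m a′≤ab∸1) ⟩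
    (b′ + a′ * suc b′) * m + m  ∎)
    where
    lemma : ∀ a′ b′ k → k * (suc a′ * suc b′) ≡ suc a′ * (suc b′ * k)
    lemma = solve-∀
    a′≤ab∸1 : a′ ≤ b′ + a′ * suc b′
    a′≤ab∸1 = ≤-trans (m≤m*n a′ (suc b′)) (m≤n+m _ b′)

  group-count : ∀ {n k} → n + m ≡ k * (suc a′ * suc b′) → m < suc b′ * k →
                ∃[ q′ ] (suc q′ + m ≡ k * suc b′) × (n + m ≡ suc a′ * (suc q′ + m))
  group-count {n} {k} n+m≡kab m<bk =
    q′ , trans q+m≡bk (*-comm (suc b′) k) ,
    trans n+m≡kab (trans (lemma a′ b′ k) (cong (suc a′ *_) (sym q+m≡bk)))
    where
    q′ : ℕ
    q′ = proj₁ (m≤n⇒∃[o]m+o≡n m<bk)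
    q+m≡bk : suc q′ + m ≡ suc b′ * k
    q+m≡bk = trans (cong suc (+-comm q′ m)) (proj₂ (m≤n⇒∃[o]m+o≡n m<bk))
    lemma : ∀ a′ b′ k → k * (suc a′ * suc b′) ≡ suc a′ * (suc b′ * k)
    lemma = solve-∀

  module _ {n q : ℕ} (n+m≡a[q+m] : n + m ≡ suc a′ * (q + m)) where

    n≡aq+a′m : n ≡ suc a′ * q + a′ * m
    n≡aq+a′m = +-cancelʳ-≡ m n _ (trans n+m≡a[q+m] (lemma a′ q m))
      where
      lemma : ∀ a′ q m → suc a′ * (q + m) ≡ (suc a′ * q + a′ * m) + m
      lemma = solve-∀

    groups≤full : ∀ {f} → n ≤ suc a′ * f + a′ * m → q ≤ f
    groups≤full n≤ = *-cancelˡ-≤ (suc a′) (+-cancelʳ-≤ (a′ * m) _ _ (subst (_≤ _) n≡aq+a′m n≤))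

    grouped-cut-bound : ∀ {g} → suc a′ * (q ∸ b′ * m) ≤ g → n ∸ g ≤ (b′ + a′ * suc b′) * m
    grouped-cut-bound {g} a[q∸b′m]≤g = m≤n+o⇒m∸n≤o n g (begin
      n                                                ≡⟨ n≡aq+a′m ⟩
      suc a′ * q + a′ * m                              ≤⟨ +-monoˡ-≤ _ (*-monoʳ-≤ (suc a′) q≤b′m+[q∸b′m]) ⟩
      suc a′ * (b′ * m + (q ∸ b′ * m)) + a′ * m        ≡⟨ lemma a′ b′ m (q ∸ b′ * m) ⟩
      suc a′ * (q ∸ b′ * m) + (b′ + a′ * suc b′) * m   ≤⟨ +-monoˡ-≤ _ a[q∸b′m]≤g ⟩
      g + (b′ + a′ * suc b′) * m                       ∎)
      where
      q≤b′m+[q∸b′m] : q ≤ b′ * m + (q ∸ b′ * m)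
      q≤b′m+[q∸b′m] = m≤n+m∸n q (b′ * m)
      lemma : ∀ a′ b′ m x → suc a′ * (b′ * m + x) + a′ * m ≡ suc a′ * x + (b′ + a′ * suc b′) * m
      lemma = solve-∀

    grouped-full-bound : ∀ {f₂ f} → q ≤ suc b′ * f₂ + b′ * m → f₂ ≤ f →
                         n ≤ (suc a′ * suc b′) * f + (b′ + a′ * suc b′) * m
    grouped-full-bound {f₂} {f} q≤bf₂+b′m f₂≤f = begin
      n                                                ≡⟨ n≡aq+a′m ⟩
      suc a′ * q + a′ * m                              ≤⟨ +-monoˡ-≤ (a′ * m) (*-monoʳ-≤ (suc a′) q≤bf+b′m) ⟩
      suc a′ * (suc b′ * f + b′ * m) + a′ * m          ≡⟨ lemma a′ b′ m f ⟩
      (suc a′ * suc b′) * f + (b′ + a′ * suc b′) * m   ∎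
      where
      q≤bf+b′m : q ≤ suc b′ * f + b′ * m
      q≤bf+b′m = ≤-trans q≤bf₂+b′m (+-monoˡ-≤ (b′ * m) (*-monoʳ-≤ (suc b′) f₂≤f))
      lemma : ∀ a′ b′ m f →
              suc a′ * (suc b′ * f + b′ * m) + a′ * m ≡ (suc a′ * suc b′) * f + (b′ + a′ * suc b′) * m
      lemma = solve-∀

-- Finite sums in an ordered field

module _ (ℝ : RealField) where
  open RealField ℝ renaming (_*_ to _·_; _≤_ to _≦_)

  ℝ-commutativeRing : CommutativeRing 0ℓ 0ℓ
  ℝ-commutativeRing = record { isCommutativeRing = isCommutativeRing }

  open CommutativeRing ℝ-commutativeRing
    using (semiring; *-commutativeSemigroup; +-group; +-identityˡ; +-identityʳ; +-assoc; +-comm;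
           *-identityˡ; *-identityʳ; *-assoc; zeroˡ; zeroʳ)
  open IsTotalOrder isTotalOrder using (antisym) renaming (refl to ≦-refl; trans to ≦-trans)
  open import Algebra.Properties.Semiring.Sum semiring
  open import Algebra.Properties.Semiring.Mult semiring using (×1-homo-*) renaming (_×_ to _×ℝ_)
  open import Algebra.Properties.Group +-group using (identityʳ-unique)
  open import Algebra.Properties.CommutativeSemigroup *-commutativeSemigroup using (x∙yz≈y∙xz; xy∙z≈y∙xz)

  ∑≡sum : ∀ {n} (f : Fin n → Carrier) → ∑ ℝ f ≡ sum f
  ∑≡sum {zero}  f = refl
  ∑≡sum {suc n} f = cong (f zero +_) (∑≡sum (f ∘ suc))

  ι-* : ∀ m n → ι ℝ (m * n) ≡ ι ℝ m · ι ℝ n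
  ι-* m n = begin
    ι ℝ (m * n)             ≡⟨ ι≡×1 (m * n) ⟩
    (m * n) ×ℝ 1#           ≡⟨ ×1-homo-* m n ⟩
    (m ×ℝ 1#) · (n ×ℝ 1#)   ≡⟨ cong₂ _·_ (ι≡×1 m) (ι≡×1 n) ⟨
    ι ℝ m · ι ℝ n           ∎
    where
    open ≡-Reasoning
    ι≡×1 : ∀ k → ι ℝ k ≡ k ×ℝ 1#
    ι≡×1 zero    = refl
    ι≡×1 (suc k) = cong (1# +_) (ι≡×1 k)

  sum-split : ∀ m {n} (f : Fin (m ℕ.+ n) → Carrier) →
              sum f ≡ ∑[ i < m ] f (i ↑ˡ n) + ∑[ j < n ] f (m ↑ʳ j)
  sum-split zero    f = sym (+-identityˡ _)
  sum-split (suc m) f = trans (cong (f zero +_) (sum-split m (f ∘ suc))) (sym (+-assoc _ _ _))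

  sum-combine : ∀ a b (f : Fin (a * b) → Carrier) → sum f ≡ ∑[ c < a ] ∑[ c′ < b ] f (combine c c′)
  sum-combine zero    b f = refl
  sum-combine (suc a) b f =
    trans (sum-split b f) (cong (∑[ c′ < b ] f (c′ ↑ˡ a * b) +_) (sum-combine a b (f ∘ (b ↑ʳ_))))

  sum-remQuot : ∀ a b (g : Fin a × Fin b → Carrier) →
                ∑[ x < a * b ] g (remQuot b x) ≡ ∑[ c < a ] ∑[ c′ < b ] g (c , c′)
  sum-remQuot a b g = trans (sum-combine a b (g ∘ remQuot b))
    (sum-cong-≗ λ c → sum-cong-≗ λ c′ → cong g (Fin.remQuot-combine c c′))

  x≦x+y : ∀ {x y} → 0# ≦ y → x ≦ x + y
  x≦x+y {x} {y} 0≦y = subst₂ _≦_ (+-identityˡ x) (+-comm y x) (+-mono-≤ x 0≦y)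

  sum-nonneg : ∀ {n} (f : Fin n → Carrier) → (∀ i → 0# ≦ f i) → 0# ≦ sum f
  sum-nonneg {zero}  f f≥0 = ≦-refl
  sum-nonneg {suc n} f f≥0 = ≦-trans (f≥0 zero) (x≦x+y (sum-nonneg (f ∘ suc) (f≥0 ∘ suc)))

  term≦sum : ∀ {n} (f : Fin n → Carrier) → (∀ i → 0# ≦ f i) → ∀ i → f i ≦ sum f
  term≦sum {suc n} f f≥0 i =
    subst (f i ≦_) (sym (sum-remove {i = i} f)) (x≦x+y (sum-nonneg (removeAt f i) (f≥0 ∘ punchIn i)))

  term≡sum⇒others≡0 : ∀ {n} (f : Fin n → Carrier) → (∀ i → 0# ≦ f i) →
                      ∀ {i j} → f i ≡ sum f → i ≢ j → f j ≡ 0#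
  term≡sum⇒others≡0 {suc n} f f≥0 {i} {j} fi≡sum i≢j = antisym fj≦0 (f≥0 j)
    where
    rest≡0 : sum (removeAt f i) ≡ 0#
    rest≡0 = identityʳ-unique (f i) _ (sym (trans fi≡sum (sum-remove {i = i} f)))
    fj≦0 : f j ≦ 0#
    fj≦0 = subst₂ _≦_ (cong f (Fin.punchIn-punchOut i≢j)) rest≡0
      (term≦sum (removeAt f i) (f≥0 ∘ punchIn i) (punchOut i≢j))

  δ : ∀ {q} → Fin q → Fin q → Carrier
  δ zero    zero    = 1#
  δ zero    (suc _) = 0#
  δ (suc _) zero    = 0#
  δ (suc β) (suc α) = δ β α

  sum-δ : ∀ {q} (β : Fin q) (f : Fin q → Carrier) → ∑[ α < q ] (δ β α · f α) ≡ f β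
  sum-δ {suc q} zero    f = trans
    (cong₂ _+_ (*-identityˡ (f zero)) (trans (sum-cong-≗ (zeroˡ ∘ f ∘ suc)) (sum-replicate-zero q)))
    (+-identityʳ (f zero))
  sum-δ         (suc β) f = trans (cong₂ _+_ (zeroˡ (f zero)) (sum-δ β (f ∘ suc))) (+-identityˡ (f (suc β)))

  δ·-nonneg : ∀ {q} (β α : Fin q) {x} → 0# ≦ x → 0# ≦ δ β α · x
  δ·-nonneg zero    zero    {x} 0≦x = subst (0# ≦_) (sym (*-identityˡ x)) 0≦x
  δ·-nonneg zero    (suc α) {x} _   = subst (0# ≦_) (sym (zeroˡ x)) ≦-refl
  δ·-nonneg (suc β) zero    {x} _   = subst (0# ≦_) (sym (zeroˡ x)) ≦-refl
  δ·-nonneg (suc β) (suc α)     0≦x = δ·-nonneg β α 0≦x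

  push : ∀ {n q} → (Fin n → Fin q) → (Fin n → Carrier) → Fin q → Carrier
  push {n} π h α = ∑[ i < n ] (δ (π i) α · h i)

  push-nonneg : ∀ {n q} (π : Fin n → Fin q) {h : Fin n → Carrier} → (∀ i → 0# ≦ h i) →
                ∀ α → 0# ≦ push π h α
  push-nonneg π h≥0 α = sum-nonneg _ (λ i → δ·-nonneg (π i) α (h≥0 i))

  sum-·push : ∀ {n q} (π : Fin n → Fin q) (g : Fin q → Carrier) (h : Fin n → Carrier) →
              ∑[ α < q ] (g α · push π h α) ≡ ∑[ i < n ] (g (π i) · h i)
  sum-·push {n} {q} π g h = begin
    ∑[ α < q ] (g α · push π h α)
      ≡⟨ sum-cong-≗ (λ α → *-distribˡ-sum (g α) (λ i → δ (π i) α · h i)) ⟩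
    ∑[ α < q ] ∑[ i < n ] (g α · (δ (π i) α · h i))
      ≡⟨ ∑-comm (λ α i → g α · (δ (π i) α · h i)) ⟩
    ∑[ i < n ] ∑[ α < q ] (g α · (δ (π i) α · h i))
      ≡⟨ sum-cong-≗ (λ i → sum-cong-≗ (λ α → x∙yz≈y∙xz (g α) (δ (π i) α) (h i))) ⟩
    ∑[ i < n ] ∑[ α < q ] (δ (π i) α · (g α · h i))
      ≡⟨ sum-cong-≗ (λ i → sum-δ (π i) (λ α → g α · h i)) ⟩
    ∑[ i < n ] (g (π i) · h i)
      ∎
    where open ≡-Reasoning

  sum-push : ∀ {n q} (π : Fin n → Fin q) (h : Fin n → Carrier) → sum (push π h) ≡ sum h
  sum-push π h = begin
    sum (push π h)                ≡⟨ sum-cong-≗ (λ α → *-identityˡ (push π h α)) ⟨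
    ∑[ α < _ ] (1# · push π h α)  ≡⟨ sum-·push π (λ _ → 1#) h ⟩
    ∑[ i < _ ] (1# · h i)         ≡⟨ sum-cong-≗ (*-identityˡ ∘ h) ⟩
    sum h                         ∎
    where open ≡-Reasoning

  -- Fair divisions

  record FairDistribution (r : ℕ) {n m} (v : Fin n → Fin m → Carrier) : Set where
    field
      share        : Fin n → Fin r → Carrier
      share-nonneg : ∀ i c → 0# ≦ share i c
      share-sum    : ∀ i → sum (share i) ≡ 1#
      fair         : ∀ c j → ι ℝ r · ∑[ i < n ] (share i c · v i j) ≡ ∑[ i < n ] v i j

  record FairDivision (r : ℕ) {n m} (v : Fin n → Fin m → Carrier) : Set where
    field
      distribution : FairDistribution r v
    open FairDistribution distribution public
    field
      cut          : Subset n
      ∣cut∣≤       : ∣ cut ∣ ≤ (r ∸ 1) * m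
      uncut        : ∀ i → i ∉ cut → Uncut ℝ share i
      full         : Fin r → Subset n
      ∣full∣≥      : ∀ c → n ≤ r * ∣ full c ∣ ℕ.+ (r ∸ 1) * m
      full⇒share≡1 : ∀ c i → i ∈ full c → share i c ≡ 1#

  HasFairDivisions : ℕ → Set
  HasFairDivisions r = ∀ {n m} → 1 ≤ n → 1 ≤ m → r ∣ n ℕ.+ m →
                       (v : Fin n → Fin m → Carrier) → (∀ i j → 0# ≦ v i j) → FairDivision r v

  Q⇒HasFairDivisions : ∀ {r} → Q ℝ r → HasFairDivisions r
  Q⇒HasFairDivisions {r} Qr 1≤n 1≤m r∣n+m v v≥0 with Qr _ _ 1≤n 1≤m r∣n+m v v≥0
  ... | w , (w≥0 , ∑w≡1) , fair , (S , ∣S∣≤ , uncut) , full = record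
    { distribution = record
      { share        = w
      ; share-nonneg = w≥0
      ; share-sum    = λ i → trans (sym (∑≡sum (w i))) (∑w≡1 i)
      ; fair         = λ c j → subst₂ (λ s t → ι ℝ r · s ≡ t)
                                  (∑≡sum (λ i → w i c · v i j)) (∑≡sum (λ i → v i j)) (fair c j)
      }
    ; cut          = S
    ; ∣cut∣≤       = ∣S∣≤
    ; uncut        = uncut
    ; full         = proj₁ ∘ full
    ; ∣full∣≥      = proj₁ ∘ proj₂ ∘ full
    ; full⇒share≡1 = proj₂ ∘ proj₂ ∘ full
    }

  HasFairDivisions⇒Q : ∀ {r} → HasFairDivisions r → Q ℝ r
  HasFairDivisions⇒Q {r} divide n m 1≤n 1≤m r∣n+m v v≥0 =
    share , (share-nonneg , λ i → trans (∑≡sum (share i)) (share-sum i)) ,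
    (λ c j → subst₂ (λ s t → ι ℝ r · s ≡ t)
               (sym (∑≡sum (λ i → share i c · v i j))) (sym (∑≡sum (λ i → v i j))) (fair c j)) ,
    (cut , ∣cut∣≤ , uncut) ,
    λ c → full c , ∣full∣≥ c , full⇒share≡1 c
    where open FairDivision (divide 1≤n 1≤m r∣n+m v v≥0)

  share≡1⇒others≡0 : ∀ {r n m} {v : Fin n → Fin m → Carrier} (D : FairDistribution r v) →
                     ∀ {i c c′} → FairDistribution.share D i c ≡ 1# → c ≢ c′ →
                     FairDistribution.share D i c′ ≡ 0#
  share≡1⇒others≡0 D {i} share≡1 c≢c′ =
    term≡sum⇒others≡0 (share i) (share-nonneg i) (trans share≡1 (sym (share-sum i))) c≢c′
    where open FairDistribution D

  full-pairwiseDisjoint : ∀ {r n m} {v : Fin n → Fin m → Carrier} (D : FairDivision r v) →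
                          PairwiseDisjoint (FairDivision.full D)
  full-pairwiseDisjoint D c≢c′ i∈full i∈full′ =
    0≢1 (trans (sym (share≡1⇒others≡0 distribution (full⇒share≡1 _ _ i∈full) c≢c′))
               (full⇒share≡1 _ _ i∈full′))
    where open FairDivision D

  portion : ∀ {n r m} → (Fin n → Fin r → Carrier) → Fin r →
            (Fin n → Fin m → Carrier) → Fin n → Fin m → Carrier
  portion w c v i j = w i c · v i j

  portion-nonneg : ∀ {r n m} {w : Fin n → Fin r → Carrier} {v : Fin n → Fin m → Carrier} →
                   (∀ i c → 0# ≦ w i c) → (∀ i j → 0# ≦ v i j) → ∀ c i j → 0# ≦ portion w c v i j
  portion-nonneg w≥0 v≥0 c i j = *-nonneg (w≥0 i c) (v≥0 i j)

  regroup : ∀ {n q m} → (Fin n → Fin q) → (Fin n → Fin m → Carrier) → Fin q → Fin m → Carrier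
  regroup π v α j = push π (λ i → v i j) α

  regroup-nonneg : ∀ {n q m} (π : Fin n → Fin q) {v : Fin n → Fin m → Carrier} →
                   (∀ i j → 0# ≦ v i j) → ∀ α j → 0# ≦ regroup π v α j
  regroup-nonneg π v≥0 α j = push-nonneg π (λ i → v≥0 i j) α

  module Product {a b n m q} {v : Fin n → Fin m → Carrier}
                 (D : FairDistribution a v) (π : Fin a → Fin n → Fin q)
                 (E : ∀ c → FairDistribution b (regroup (π c) (portion (FairDistribution.share D) c v))) where
    private
      module D = FairDistribution D
      module E c = FairDistribution (E c)

    share : Fin n → Fin (a * b) → Carrier
    share i x = let c , c′ = remQuot {a} b x in D.share i c · E.share c (π c i) c′

    share-sum : ∀ i → sum (share i) ≡ 1#
    share-sum i = begin
      sum (share i)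
        ≡⟨ sum-remQuot a b (λ (c , c′) → D.share i c · E.share c (π c i) c′) ⟩
      ∑[ c < a ] ∑[ c′ < b ] (D.share i c · E.share c (π c i) c′)
        ≡⟨ sum-cong-≗ (λ c → *-distribˡ-sum (D.share i c) (E.share c (π c i))) ⟨
      ∑[ c < a ] (D.share i c · sum (E.share c (π c i)))
        ≡⟨ sum-cong-≗ (λ c → cong (D.share i c ·_) (E.share-sum c (π c i))) ⟩
      ∑[ c < a ] (D.share i c · 1#)
        ≡⟨ sum-cong-≗ (*-identityʳ ∘ D.share i) ⟩
      sum (D.share i)
        ≡⟨ D.share-sum i ⟩
      1#
        ∎
      where open ≡-Reasoning

    fair : ∀ x j → ι ℝ (a * b) · ∑[ i < n ] (share i x · v i j) ≡ ∑[ i < n ] v i j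
    fair x j = begin
      ι ℝ (a * b) · ∑[ i < n ] (share i x · v i j)
        ≡⟨ cong₂ _·_ (ι-* a b) (sum-cong-≗ λ i → xy∙z≈y∙xz (D.share i c) (E.share c (π c i) c′) (v i j)) ⟩
      (ι ℝ a · ι ℝ b) · ∑[ i < n ] (E.share c (π c i) c′ · portion D.share c v i j)
        ≡⟨ *-assoc (ι ℝ a) (ι ℝ b) _ ⟩
      ι ℝ a · (ι ℝ b · ∑[ i < n ] (E.share c (π c i) c′ · portion D.share c v i j))
        ≡⟨ cong (λ s → ι ℝ a · (ι ℝ b · s))
             (sum-·push (π c) (λ α → E.share c α c′) (λ i → portion D.share c v i j)) ⟨
      ι ℝ a · (ι ℝ b · ∑[ α < q ] (E.share c α c′ · regroup (π c) (portion D.share c v) α j))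
        ≡⟨ cong (ι ℝ a ·_) (E.fair c c′ j) ⟩
      ι ℝ a · ∑[ α < q ] regroup (π c) (portion D.share c v) α j
        ≡⟨ cong (ι ℝ a ·_) (sum-push (π c) (λ i → portion D.share c v i j)) ⟩
      ι ℝ a · ∑[ i < n ] (D.share i c · v i j)
        ≡⟨ D.fair c j ⟩
      ∑[ i < n ] v i j
        ∎
      where
      open ≡-Reasoning
      c : Fin a
      c = proj₁ (remQuot {a} b x)
      c′ : Fin b
      c′ = proj₂ (remQuot {a} b x)

    distribution : FairDistribution (a * b) v
    distribution = record
      { share        = share
      ; share-nonneg = λ i x → *-nonneg (D.share-nonneg i _) (E.share-nonneg _ _ _)
      ; share-sum    = share-sum
      ; fair         = fair
      }

    uncut : ∀ {i c} → D.share i c ≡ 1# → Uncut ℝ (E.share c) (π c i) → Uncut ℝ share i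
    uncut {i} {c} share≡1 uncut′ x = pair-uncut (proj₁ (remQuot {a} b x)) (proj₂ (remQuot {a} b x))
      where
      pair-uncut : ∀ d d′ → (D.share i d · E.share d (π d i) d′ ≡ 0#) ⊎
                            (D.share i d · E.share d (π d i) d′ ≡ 1#)
      pair-uncut d d′ with c Fin.≟ d
      ... | yes refl = Sum.map (λ e → trans (cong₂ _·_ share≡1 e) (zeroʳ 1#))
                               (λ e → trans (cong₂ _·_ share≡1 e) (*-identityʳ 1#)) (uncut′ d′)
      ... | no c≢d   = inj₁ (trans (cong (_· _) (share≡1⇒others≡0 D share≡1 c≢d)) (zeroˡ _))

  few-cookies-division : ∀ {a′ b′ n m k} {v : Fin n → Fin m → Carrier} →
                         n ℕ.+ m ≡ k * (suc a′ * suc b′) → suc b′ * k ≤ m →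
                         (D : FairDistribution (suc a′) v) →
                         (∀ c → FairDistribution (suc b′)
                                  (regroup id (portion (FairDistribution.share D) c v))) →
                         FairDivision (suc a′ * suc b′) v
  few-cookies-division {a′} {b′} {n} {m} n+m≡kab bk≤m D E = record
    { distribution = Product.distribution D (λ _ → id) E
    ; cut          = ⊤
    ; ∣cut∣≤       = subst (_≤ _) (sym (∣⊤∣≡n n)) n≤[ab∸1]m
    ; uncut        = λ i i∉⊤ → contradiction ∈⊤ i∉⊤
    ; full         = λ _ → ⊥
    ; ∣full∣≥      = λ _ → ℕₚ.≤-trans n≤[ab∸1]m (ℕₚ.m≤n+m _ _)
    ; full⇒share≡1 = λ _ _ i∈⊥ → contradiction i∈⊥ ∉⊥
    }
    where
    n≤[ab∸1]m : n ≤ (b′ ℕ.+ a′ * suc b′) * m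
    n≤[ab∸1]m = few-cookies-bound {a′} {b′} n+m≡kab bk≤m

  module Grouped {a′ b′ n m q} {v : Fin n → Fin m → Carrier} (n+m≡a[q+m] : n ℕ.+ m ≡ suc a′ * (q ℕ.+ m))
                 (D : FairDivision (suc a′) v) (π : Fin (suc a′) → Fin n → Fin q)
                 (π-onto : ∀ c → MapsOnto (π c) (FairDivision.full D c) ⊤)
                 (E : ∀ c → FairDivision (suc b′) (regroup (π c) (portion (FairDivision.share D) c v))) where
    private
      module D = FairDivision D
      module E c = FairDivision (E c)
      module P = Product D.distribution π E.distribution

    ∣T∣≤∣full∩preimage∣ : ∀ c T → ∣ T ∣ ≤ ∣ D.full c ∩ preimage (π c) T ∣
    ∣T∣≤∣full∩preimage∣ c T = MapsOnto⇒∣T∣≤∣Y∣ (π c) _ T (MapsOnto-∩-preimage T (π-onto c))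

    kept-by : Fin (suc a′) → Subset n
    kept-by c = D.full c ∩ preimage (π c) (∁ (E.cut c))

    kept : Subset n
    kept = ⋃ᶠ kept-by

    -- π c maps D.full c onto the groups, so each group not cut by E c puts a cookie into kept-by c.
    a[q∸b′m]≤∣kept∣ : suc a′ * (q ∸ b′ * m) ≤ ∣ kept ∣
    a[q∸b′m]≤∣kept∣ = PairwiseDisjoint⇒*≤∣⋃ᶠ∣ kept-by
      (λ c≢c′ i∈ i∈′ → full-pairwiseDisjoint D c≢c′ (proj₁ (x∈p∩q⁻ _ _ i∈)) (proj₁ (x∈p∩q⁻ _ _ i∈′)))
      (λ c → ℕₚ.≤-trans (ℕₚ.∸-monoʳ-≤ q (E.∣cut∣≤ c))
               (subst (_≤ ∣ kept-by c ∣) (∣∁p∣≡n∸∣p∣ (E.cut c)) (∣T∣≤∣full∩preimage∣ c (∁ (E.cut c)))))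

    uncut : ∀ i → i ∉ ∁ kept → Uncut ℝ P.share i
    uncut i i∉∁kept =
      let c , i∈kept-by = x∈⋃ᶠ⁻ kept-by (x∉∁p⇒x∈p i∉∁kept)
          i∈full , i∈preimage = x∈p∩q⁻ _ _ i∈kept-by
      in P.uncut (D.full⇒share≡1 c i i∈full) (E.uncut c (π c i) (x∈∁p⇒x∉p (x∈preimage⁻ i∈preimage)))

    full : Fin (suc a′ * suc b′) → Subset n
    full x = let c , c′ = remQuot {suc a′} (suc b′) x in D.full c ∩ preimage (π c) (E.full c c′)

    full⇒share≡1 : ∀ x i → i ∈ full x → P.share i x ≡ 1#
    full⇒share≡1 x i i∈full =
      let c , c′ = remQuot {suc a′} (suc b′) x
          i∈D-full , i∈preimage = x∈p∩q⁻ _ _ i∈full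
      in trans (cong₂ _·_ (D.full⇒share≡1 c i i∈D-full)
                          (E.full⇒share≡1 c c′ (π c i) (x∈preimage⁻ i∈preimage)))
               (*-identityˡ 1#)

    division : FairDivision (suc a′ * suc b′) v
    division = record
      { distribution = P.distribution
      ; cut          = ∁ kept
      ; ∣cut∣≤       = subst (_≤ _) (sym (∣∁p∣≡n∸∣p∣ kept))
                         (grouped-cut-bound {a′} {b′} n+m≡a[q+m] a[q∸b′m]≤∣kept∣)
      ; uncut        = uncut
      ; full         = full
      ; ∣full∣≥      = λ x → let c , c′ = remQuot {suc a′} (suc b′) x in
                         grouped-full-bound {a′} {b′} n+m≡a[q+m]
                           (E.∣full∣≥ c c′) (∣T∣≤∣full∩preimage∣ c (E.full c c′))
      ; full⇒share≡1 = full⇒share≡1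
      }

  HasFairDivisions-* : ∀ {a′ b′} → HasFairDivisions (suc a′) → HasFairDivisions (suc b′) →
                       HasFairDivisions (suc a′ * suc b′)
  HasFairDivisions-* {a′} {b′} divideᵃ divideᵇ {n} {m} 1≤n 1≤m (divides k n+m≡kab) v v≥0 =
    case m ℕ.<? suc b′ * k of λ where
      (no m≮bk) → few-cookies-division {a′} {b′} n+m≡kab (ℕₚ.≮⇒≥ m≮bk) D.distribution λ c →
        FairDivision.distribution (divideᵇ 1≤n 1≤m b∣n+m _ (regroup-nonneg id (portion≥0 c)))
      (yes m<bk) →
        let q′ , q+m≡kb , n+m≡a[q+m] = group-count {a′} {b′} n+m≡kab m<bk
            onto c = ≤∣Y∣⇒∃MapsOnto-⊤ (D.full c) (groups≤full {a′} {b′} n+m≡a[q+m] (D.∣full∣≥ c))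
        in Grouped.division {b′ = b′} n+m≡a[q+m] D (proj₁ ∘ onto) (proj₂ ∘ onto) λ c →
             divideᵇ (s≤s z≤n) 1≤m (divides k q+m≡kb) _ (regroup-nonneg (proj₁ (onto c)) (portion≥0 c))
    where
    D : FairDivision (suc a′) v
    D = divideᵃ 1≤n 1≤m (∣-trans (m∣m*n (suc b′)) (divides k n+m≡kab)) v v≥0
    module D = FairDivision D
    b∣n+m : suc b′ ∣ n ℕ.+ m
    b∣n+m = ∣-trans (n∣m*n (suc a′)) (divides k n+m≡kab)
    portion≥0 : ∀ c i j → 0# ≦ portion D.share c v i j
    portion≥0 = portion-nonneg D.share-nonneg v≥0

lemma6p1 : (ℝ : RealField) → (a b : ℕ) → 1 ≤ a → 1 ≤ b →
           Q ℝ a → Q ℝ b → Q ℝ (a * b)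
lemma6p1 ℝ _ _ (s≤s z≤n) (s≤s z≤n) Qa Qb =
  HasFairDivisions⇒Q ℝ (HasFairDivisions-* ℝ (Q⇒HasFairDivisions ℝ Qa) (Q⇒HasFairDivisions ℝ Qb))
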